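{- Let $G$ be a connected graph such that for every pair $u,v$ of distinct vertices of $G$ we have $N[u]\not\subseteq N[v]$. Then $\gamma_{\rm tcg}(G) = \gamma_{\rm cg}(G)$, i.e. $G$ is Class~$0$.
   Context: All graphs are finite and simple; $N[v]$ denotes the closed neighborhood of $v$. The connected domination game on a connected graph $G$ is played by Dominator and Staller, who alternately select previously unselected vertices, Dominator moving first; each selected vertex must dominate (have in its closed neighborhood) at least one vertex not dominated by the previously selected vertices, and at every stage the selected vertices must induce a connected subgraph. The game ends when no legal move exists; Dominator wants to minimize and Staller to maximize the number of selected vertices; under optimal play this number is $\gamma_{\rm cg}(G)$. The total connected domination game is the same except each selected vertex must totally dominate (have in its open neighborhood) at least one vertex not yet totally dominated by previously selected vertices; its optimal value is $\gamma_{\rm tcg}(G)$. A connected graph $G$ is Class~$i$ ($i\in\{0,1,2\}$) if $\gamma_{\rm tcg}(G)=\gamma_{\rm cg}(G)+i$. -}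

module Defs where

open import Data.Nat using (ℕ; zero; suc; _≤_)
open import Data.Fin using (Fin)
open import Data.List using (List; []; _∷_)
open import Data.List.Membership.Propositional using (_∈_; _∉_)
open import Data.Product using (Σ; ∃; _×_; _,_)
open import Data.Sum using (_⊎_)
open import Data.Unit using (⊤)
open import Relation.Nullary using (¬_)
open import Relation.Binary using (Decidable)
open import Relation.Binary.PropositionalEquality using (_≡_; _≢_)

record Graph : Set₁ where
  field
    n      : ℕ
    Adj    : Fin n → Fin n → Set
    Adj?   : Decidable Adj
    sym    : ∀ {u v} → Adj u v → Adj v u
    irrefl : ∀ {u} → ¬ Adj u u

module _ (G : Graph) where
  open Graph G

  V : Set
  V = Fin n

  InClosedNbhd : V → V → Set
  InClosedNbhd v w = (v ≡ w) ⊎ Adj v w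

  ClosedNbhdSubset : V → V → Set
  ClosedNbhdSubset u v = ∀ w → InClosedNbhd u w → InClosedNbhd v w

  -- walks all of whose vertices after the first satisfy P
  data Walk (P : V → Set) : V → V → Set where
    here : ∀ {x} → Walk P x x
    step : ∀ {x y z} → Adj x y → P y → Walk P y z → Walk P x z

  Connected : Set
  Connected = ∀ x y → Walk (λ _ → ⊤) x y

  InducedConnected : List V → Set
  InducedConnected S = ∀ x y → x ∈ S → y ∈ S → Walk (_∈ S) x y

  Dominated : List V → V → Set
  Dominated S w = ∃ λ s → s ∈ S × InClosedNbhd s w

  TotDominated : List V → V → Set
  TotDominated S w = ∃ λ s → s ∈ S × Adj s w

  CgMove : List V → V → Set
  CgMove S v = v ∉ S × (∃ λ w → InClosedNbhd v w × ¬ Dominated S w)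
               × InducedConnected (v ∷ S)

  TcgMove : List V → V → Set
  TcgMove S v = v ∉ S × (∃ λ w → Adj v w × ¬ TotDominated S w)
                × InducedConnected (v ∷ S)

  data Player : Set where
    dominator staller : Player

  -- Generic two-player game (Dominator minimises, Staller maximises the
  -- number of moves) with legal-move relation Move; the state is the list
  -- of selected vertices (most recent first) and the player to move.
  module Game (Move : List V → V → Set) where

    -- Dominator can force that at most k further moves are played
    data DomAtMost : Player → List V → ℕ → Set where
      over : ∀ {p S k} → (∀ v → ¬ Move S v) → DomAtMost p S k
      dmov : ∀ {S k} v → Move S v → DomAtMost staller (v ∷ S) k
             → DomAtMost dominator S (suc k)
      smov : ∀ {S k} → (∀ v → Move S v → DomAtMost dominator (v ∷ S) k)
             → DomAtMost staller S (suc k)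

    -- Staller can force that at least k further moves are played
    data StaAtLeast : Player → List V → ℕ → Set where
      none : ∀ {p S} → StaAtLeast p S zero
      dmov : ∀ {S k} → (∃ λ v → Move S v)
             → (∀ v → Move S v → StaAtLeast staller (v ∷ S) k)
             → StaAtLeast dominator S (suc k)
      smov : ∀ {S k} v → Move S v → StaAtLeast dominator (v ∷ S) k
             → StaAtLeast staller S (suc k)

    IsValue : ℕ → Set
    IsValue k = DomAtMost dominator [] k × StaAtLeast dominator [] k

  IsγCg : ℕ → Set
  IsγCg = Game.IsValue CgMove

  IsγTcg : ℕ → Set
  IsγTcg = Game.IsValue TcgMove

-- Once the selected set S induces a connected subgraph with at least two
-- vertices, every vertex of S has a neighbour in S, so "dominated by S" and
-- "totally dominated by S" coincide; a legal move must also be adjacent to S,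
-- hence never newly dominates itself.  So the legal moves of the two games are
-- the same, except possibly for the first two moves.  The first move is legal
-- in both games because no vertex is isolated; after a first move a, a second
-- move v is adjacent to a, and it is legal in the total game (it totally
-- dominates a) and in the ordinary game (some vertex of N[v] lies outside
-- N[a]).  Identical game trees have identical values, and every finite game
-- has a value by backward induction.
module Submission where

open import Defs
open import Level using (Level)
open import Function using (_∘_; _⇔_; mk⇔; Equivalence)
open import Data.Nat using (ℕ; zero; suc; _≤_; _<_; z≤n; s≤s)
open import Data.Nat.Properties using (≤-totalPreorder)
open import Data.Nat.Induction using (<-wellFounded)
open import Induction.WellFounded using (Acc; acc)
open import Data.Fin using (Fin; zero; suc; _≟_)
open import Data.Fin.Properties using (any?)
open import Data.Fin.Subset as Sub using (Subset; ∣_∣)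
open import Data.Fin.Subset.Properties using (∈⊤; x∈p∧x≢y⇒x∈p-y; x∈p⇒∣p-x∣<∣p∣)
open import Data.List using (List; []; _∷_; foldr)
open import Data.List.Membership.Propositional using (_∈_; _∉_; find; lose)
import Data.List.Membership.DecPropositional as DecMembership
open import Data.List.Relation.Unary.Any using (here; there)
import Data.List.Relation.Unary.Any as Any
open import Data.List.Relation.Unary.All as All using (All)
open import Data.List.Relation.Unary.All.Properties.Core using (¬All⇒Any¬)
open import Data.Product using (∃; _×_; _,_; proj₁; proj₂)
open import Data.Sum using (_⊎_; inj₁; inj₂)
open import Data.Empty using (⊥-elim)
open import Relation.Nullary using (¬_; Dec; yes; no)
open import Relation.Nullary.Decidable using (_⊎-dec_; _×-dec_; ¬?; map′; decidable-stable)
open import Relation.Unary using (Pred; Decidable)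
open import Relation.Binary.Bundles using (TotalPreorder)
import Relation.Binary.Construct.Flip.EqAndOrd as Flip
open import Relation.Binary.PropositionalEquality using (_≡_; _≢_; refl; sym; subst)

module _ {c ℓ₁ ℓ₂ p : Level} (O : TotalPreorder c ℓ₁ ℓ₂) where
  open TotalPreorder O using (Carrier; _≲_; trans; total) renaming (refl to ≲-refl)

  optimum : ∀ {m} {P : Pred (Fin m) p} → Decidable P → (f : Fin m → Carrier)
          → ∃ P → ∃ λ i → P i × (∀ {j} → P j → f i ≲ f j)
  optimum {zero} P? f (() , _)
  optimum {suc m} {P} P? f ∃P with P? zero | any? (P? ∘ suc)
  ... | no ¬P0 | no ¬Ps = ⊥-elim (nowhere ∃P)
    where
    nowhere : ¬ ∃ P
    nowhere (zero , P0) = ¬P0 P0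
    nowhere (suc i , Pi) = ¬Ps (i , Pi)
  ... | yes P0 | no ¬Ps = zero , P0 , λ { {zero} _ → ≲-refl ; {suc j} Pj → ⊥-elim (¬Ps (j , Pj)) }
  ... | P0? | yes ∃Ps with optimum (P? ∘ suc) (f ∘ suc) ∃Ps
  ...   | i , Pi , i-opt with P0?
  ...     | no ¬P0 = suc i , Pi , λ { {zero} P0 → ⊥-elim (¬P0 P0) ; {suc j} → i-opt }
  ...     | yes P0 with total (f zero) (f (suc i))
  ...       | inj₁ 0≲i = zero , P0 , λ { {zero} _ → ≲-refl ; {suc j} Pj → trans 0≲i (i-opt Pj) }
  ...       | inj₂ i≲0 = suc i , Pi , λ { {zero} _ → i≲0 ; {suc j} → i-opt }

unselected : ∀ {m} → List (Fin m) → Subset m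
unselected = foldr (λ v p → p Sub.- v) Sub.⊤

∉⇒∈unselected : ∀ {m} {v : Fin m} S → v ∉ S → v Sub.∈ unselected S
∉⇒∈unselected [] _ = ∈⊤
∉⇒∈unselected (u ∷ S) v∉ = x∈p∧x≢y⇒x∈p-y (∉⇒∈unselected S (v∉ ∘ there)) (v∉ ∘ here)

∣unselected-∷∣<∣unselected∣ : ∀ {m} {v : Fin m} {S} → v ∉ S → ∣ unselected (v ∷ S) ∣ < ∣ unselected S ∣
∣unselected-∷∣<∣unselected∣ {S = S} v∉ = x∈p⇒∣p-x∣<∣p∣ (∉⇒∈unselected S v∉)

module _ (G : Graph) (Move : List (V G) → V G → Set) where
  open Game G Move

  IsValueAt : Player G → List (V G) → ℕ → Set
  IsValueAt p S k = DomAtMost p S k × StaAtLeast p S k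

  domAtMost-mono : ∀ {p S k k′} → k ≤ k′ → DomAtMost p S k → DomAtMost p S k′
  domAtMost-mono _ (over stuck) = over stuck
  domAtMost-mono (s≤s k≤k′) (dmov v m d) = dmov v m (domAtMost-mono k≤k′ d)
  domAtMost-mono (s≤s k≤k′) (smov d) = smov λ v m → domAtMost-mono k≤k′ (d v m)

  staAtLeast-mono : ∀ {p S k k′} → k′ ≤ k → StaAtLeast p S k → StaAtLeast p S k′
  staAtLeast-mono z≤n _ = none
  staAtLeast-mono (s≤s k′≤k) (dmov ∃m s) = dmov ∃m λ v m → staAtLeast-mono k′≤k (s v m)
  staAtLeast-mono (s≤s k′≤k) (smov v m s) = smov v m (staAtLeast-mono k′≤k s)

module GameValue (G : Graph) (Move : List (V G) → V G → Set)
  (Inv : List (V G) → Set)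
  (inv-step : ∀ {S v} → Inv S → Move S v → Inv (v ∷ S))
  (move? : ∀ {S} → Inv S → Decidable (Move S))
  (move-fresh : ∀ {S v} → Move S v → v ∉ S) where
  open Game G Move

  value : ∀ p S → Inv S → Acc _<_ ∣ unselected S ∣ → ∃ (IsValueAt G Move p S)
  value p S inv (acc rs) with any? (move? inv)
  ... | no ¬∃move = 0 , over (λ v m → ¬∃move (v , m)) , none
  ... | yes ∃move = optimal p
    where
    next : ∀ q {v} → Move S v → ∃ (IsValueAt G Move q (v ∷ S))
    next q m = value q _ (inv-step inv m) (rs (∣unselected-∷∣<∣unselected∣ (move-fresh m)))

    -- 0 is a junk value for vertices that are not legal moves
    nextValue : Player G → V G → ℕ
    nextValue q v with move? inv v
    ... | yes m = proj₁ (next q m)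
    ... | no _ = 0

    nextValue-isValue : ∀ q {v} → Move S v → IsValueAt G Move q (v ∷ S) (nextValue q v)
    nextValue-isValue q {v} m with move? inv v
    ... | yes m′ = proj₂ (next q m′)
    ... | no ¬m = ⊥-elim (¬m m)

    optimal : ∀ p → ∃ (IsValueAt G Move p S)
    optimal dominator =
      let v , m , v-min = optimum ≤-totalPreorder (move? inv) (nextValue staller) ∃move
      in suc (nextValue staller v)
         , dmov v m (proj₁ (nextValue-isValue staller m))
         , dmov ∃move (λ w mw → staAtLeast-mono G Move (v-min mw) (proj₂ (nextValue-isValue staller mw)))
    optimal staller =
      let v , m , v-max = optimum (Flip.totalPreorder ≤-totalPreorder) (move? inv) (nextValue dominator) ∃move
      in suc (nextValue dominator v)
         , smov (λ w mw → domAtMost-mono G Move (v-max mw) (proj₁ (nextValue-isValue dominator mw)))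
         , smov v m (proj₂ (nextValue-isValue dominator m))

  gameValue : Inv [] → ∃ (Game.IsValue G Move)
  gameValue inv = value dominator [] inv (<-wellFounded _)

module GameTransfer (G : Graph) {Move₁ Move₂ : List (V G) → V G → Set}
  (Inv : List (V G) → Set)
  (inv-step : ∀ {S v} → Inv S → Move₁ S v → Inv (v ∷ S))
  (same-moves : ∀ {S v} → Inv S → Move₁ S v ⇔ Move₂ S v) where
  private
    module G₁ = Game G Move₁
    module G₂ = Game G Move₂
    to : ∀ {S v} → Inv S → Move₁ S v → Move₂ S v
    to inv = Equivalence.to (same-moves inv)
    from : ∀ {S v} → Inv S → Move₂ S v → Move₁ S v
    from inv = Equivalence.from (same-moves inv)

  domAtMost-transfer : ∀ {p S k} → Inv S → G₁.DomAtMost p S k → G₂.DomAtMost p S k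
  domAtMost-transfer inv (G₁.over stuck) = G₂.over λ v m → stuck v (from inv m)
  domAtMost-transfer inv (G₁.dmov v m d) = G₂.dmov v (to inv m) (domAtMost-transfer (inv-step inv m) d)
  domAtMost-transfer inv (G₁.smov d) =
    G₂.smov λ v m → domAtMost-transfer (inv-step inv (from inv m)) (d v (from inv m))

  staAtLeast-transfer : ∀ {p S k} → Inv S → G₁.StaAtLeast p S k → G₂.StaAtLeast p S k
  staAtLeast-transfer inv G₁.none = G₂.none
  staAtLeast-transfer inv (G₁.dmov (v , m) s) =
    G₂.dmov (v , to inv m) λ w mw → staAtLeast-transfer (inv-step inv (from inv mw)) (s w (from inv mw))
  staAtLeast-transfer inv (G₁.smov v m s) = G₂.smov v (to inv m) (staAtLeast-transfer (inv-step inv m) s)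

both-hold⇒⇔ : ∀ {a b} {A : Set a} {B : Set b} → A → B → A ⇔ B
both-hold⇒⇔ x y = mk⇔ (λ _ → y) (λ _ → x)

allEqual⊎∃distinct : ∀ {m} (a : Fin m) S → All (_≡ a) S ⊎ ∃ λ t → t ∈ S × t ≢ a
allEqual⊎∃distinct a S with All.all? (_≟ a) S
... | yes all≡a = inj₁ all≡a
... | no ¬all≡a = inj₂ (find (¬All⇒Any¬ (_≟ a) S ¬all≡a))

∃≢ : ∀ {m} → 2 ≤ m → (v : Fin m) → ∃ (_≢ v)
∃≢ (s≤s (s≤s _)) zero = suc zero , λ ()
∃≢ (s≤s (s≤s _)) (suc v) = zero , λ ()

module _ (G : Graph) where
  open Graph G using (n; Adj; Adj?; irrefl) renaming (sym to adj-sym)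
  open DecMembership (_≟_ {n}) using (_∈?_)

  private
    IC : List (V G) → Set
    IC = InducedConnected G

  walk-map : ∀ {P Q : V G → Set} → (∀ {x} → P x → Q x) → ∀ {x y} → Walk G P x y → Walk G Q x y
  walk-map f here = here
  walk-map f (step a p w) = step a (f p) (walk-map f w)

  walk-++ : ∀ {P : V G → Set} {x y z} → Walk G P x y → Walk G P y z → Walk G P x z
  walk-++ here w′ = w′
  walk-++ (step a p w) w′ = step a p (walk-++ w w′)

  walk-first-step : ∀ {P : V G → Set} {x y} → Walk G P x y → x ≢ y → ∃ λ z → Adj x z × P z
  walk-first-step here x≢x = ⊥-elim (x≢x refl)
  walk-first-step (step a p _) _ = _ , a , p

  has-neighbour : 2 ≤ n → Connected G → ∀ v → ∃ (Adj v)
  has-neighbour n≥2 connected v =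
    let u , u≢v = ∃≢ n≥2 v
        z , v~z , _ = walk-first-step (connected v u) (u≢v ∘ sym)
    in z , v~z

  inClosedNbhd? : ∀ x y → Dec (InClosedNbhd G x y)
  inClosedNbhd? x y = (x ≟ y) ⊎-dec Adj? x y

  ¬ClosedNbhdSubset⇒∃ : ∀ {u v} → ¬ ClosedNbhdSubset G u v
                      → ∃ λ w → InClosedNbhd G u w × ¬ InClosedNbhd G v w
  ¬ClosedNbhdSubset⇒∃ {u} {v} u⊈v with any? (λ w → inClosedNbhd? u w ×-dec ¬? (inClosedNbhd? v w))
  ... | yes witness = witness
  ... | no none = ⊥-elim (u⊈v λ w u~w → decidable-stable (inClosedNbhd? v w) λ ¬v~w → none (w , u~w , ¬v~w))

  dominated? : ∀ S w → Dec (Dominated G S w)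
  dominated? S w = map′ find (λ (s , s∈S , s~w) → lose s∈S s~w) (Any.any? (λ s → inClosedNbhd? s w) S)

  inducedConnected-[] : IC []
  inducedConnected-[] _ _ ()

  inducedConnected-[_] : ∀ v → IC (v ∷ [])
  inducedConnected-[ v ] _ _ (here refl) (here refl) = here

  inducedConnected-∷ : ∀ {S v s} → IC S → s ∈ S → Adj v s → IC (v ∷ S)
  inducedConnected-∷ ic s∈S v~s _ _ (here refl) (here refl) = here
  inducedConnected-∷ {s = s} ic s∈S v~s _ y (here refl) (there y∈S) =
    step v~s (there s∈S) (walk-map there (ic s y s∈S y∈S))
  inducedConnected-∷ {s = s} ic s∈S v~s x _ (there x∈S) (here refl) =
    walk-++ (walk-map there (ic x s x∈S s∈S)) (step (adj-sym v~s) (here refl) here)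
  inducedConnected-∷ ic s∈S v~s x y (there x∈S) (there y∈S) = walk-map there (ic x y x∈S y∈S)

  adjacent-to-selected : ∀ {S v s} → IC (v ∷ S) → v ∉ S → s ∈ S → ∃ λ t → t ∈ S × Adj v t
  adjacent-to-selected {v = v} {s} ic v∉S s∈S with ic v s (here refl) (there s∈S)
  ... | here = ⊥-elim (v∉S s∈S)
  ... | step v~t (here t≡v) _ = ⊥-elim (irrefl (subst (Adj v) t≡v v~t))
  ... | step v~t (there t∈S) _ = _ , t∈S , v~t

  inducedConnected-∷? : ∀ {S} → IC S → ∀ {v} → v ∉ S → Dec (IC (v ∷ S))
  inducedConnected-∷? {[]} _ {v} _ = yes inducedConnected-[ v ]
  inducedConnected-∷? {S@(s ∷ _)} ic {v} v∉S =
    map′ (λ v~S → let t , t∈S , v~t = find v~S in inducedConnected-∷ ic t∈S v~t)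
         (λ ic′ → let t , t∈S , v~t = adjacent-to-selected ic′ v∉S (here refl) in lose t∈S v~t)
         (Any.any? (Adj? v) S)

  cgMove? : ∀ {S} → IC S → Decidable (CgMove G S)
  cgMove? {S} ic v with v ∈? S
  ... | yes v∈S = no λ (v∉S , _) → v∉S v∈S
  ... | no v∉S =
    map′ (λ (new , ic′) → v∉S , new , ic′) (λ (_ , new , ic′) → new , ic′)
         (any? (λ w → inClosedNbhd? v w ×-dec ¬? (dominated? S w)) ×-dec inducedConnected-∷? ic v∉S)

  neighbour-in-selected : ∀ {S u u′} → IC S → u ∈ S → u′ ∈ S → u ≢ u′
                        → ∀ {s} → s ∈ S → ∃ λ t → t ∈ S × Adj s t
  neighbour-in-selected {u = u} {u′} ic u∈S u′∈S u≢u′ {s} s∈S with u ≟ s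
  ... | yes refl = let z , s~z , z∈S = walk-first-step (ic s u′ s∈S u′∈S) u≢u′ in z , z∈S , s~z
  ... | no u≢s = let z , s~z , z∈S = walk-first-step (ic s u s∈S u∈S) (u≢s ∘ sym) in z , z∈S , s~z

  totDominated⇒dominated : ∀ {S w} → TotDominated G S w → Dominated G S w
  totDominated⇒dominated (s , s∈S , s~w) = s , s∈S , inj₂ s~w

  dominated⇒totDominated : ∀ {S} → (∀ {s} → s ∈ S → ∃ λ t → t ∈ S × Adj s t)
                         → ∀ {w} → Dominated G S w → TotDominated G S w
  dominated⇒totDominated nbr (w , w∈S , inj₁ refl) = let t , t∈S , w~t = nbr w∈S in t , t∈S , adj-sym w~t
  dominated⇒totDominated nbr (s , s∈S , inj₂ s~w) = s , s∈S , s~w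

  DominatesNew TotDominatesNew : List (V G) → V G → Set
  DominatesNew S v = ∃ λ w → InClosedNbhd G v w × ¬ Dominated G S w
  TotDominatesNew S v = ∃ λ w → Adj v w × ¬ TotDominated G S w

  dominatesNew⇔totDominatesNew-nontrivial : ∀ {S u u′ v} → IC S → u ∈ S → u′ ∈ S → u ≢ u′
    → IC (v ∷ S) → v ∉ S → DominatesNew S v ⇔ TotDominatesNew S v
  dominatesNew⇔totDominatesNew-nontrivial {S} {v = v} ic u∈S u′∈S u≢u′ ic′ v∉S = mk⇔ to from
    where
    nbr : ∀ {s} → s ∈ S → ∃ λ t → t ∈ S × Adj s t
    nbr = neighbour-in-selected ic u∈S u′∈S u≢u′

    to : DominatesNew S v → TotDominatesNew S v
    to (_ , inj₁ refl , ¬dom) =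
      let t , t∈S , v~t = adjacent-to-selected ic′ v∉S u∈S in ⊥-elim (¬dom (t , t∈S , inj₂ (adj-sym v~t)))
    to (w , inj₂ v~w , ¬dom) = w , v~w , ¬dom ∘ totDominated⇒dominated

    from : TotDominatesNew S v → DominatesNew S v
    from (w , v~w , ¬tot) = w , inj₂ v~w , ¬tot ∘ dominated⇒totDominated nbr

  totDominatesNew-onlyVertex : ∀ {S a v} → All (_≡ a) S → Adj v a → TotDominatesNew S v
  totDominatesNew-onlyVertex {a = a} all≡a v~a =
    a , v~a , λ (s , s∈S , s~a) → irrefl (subst (λ x → Adj x a) (All.lookup all≡a s∈S) s~a)

  dominatesNew-onlyVertex : ∀ {S a v} → ¬ ClosedNbhdSubset G v a → All (_≡ a) S → DominatesNew S v
  dominatesNew-onlyVertex v⊈a all≡a =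
    let w , v~w , ¬a~w = ¬ClosedNbhdSubset⇒∃ v⊈a
    in w , v~w , λ (s , s∈S , s~w) → ¬a~w (subst (λ x → InClosedNbhd G x w) (All.lookup all≡a s∈S) s~w)

  module _ (n≥2 : 2 ≤ n) (connected : Connected G)
           (twin-free : ∀ u v → u ≢ v → ¬ ClosedNbhdSubset G u v) where

    dominatesNew⇔totDominatesNew : ∀ {S v} → IC S → IC (v ∷ S) → v ∉ S
                                   → DominatesNew S v ⇔ TotDominatesNew S v
    dominatesNew⇔totDominatesNew {[]} {v} _ _ _ =
      let w , v~w = has-neighbour n≥2 connected v
      in both-hold⇒⇔ (v , inj₁ refl , λ ()) (w , v~w , λ ())
    dominatesNew⇔totDominatesNew {S@(a ∷ _)} {v} ic ic′ v∉S with allEqual⊎∃distinct a S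
    ... | inj₂ (t , t∈S , t≢a) = dominatesNew⇔totDominatesNew-nontrivial ic t∈S (here refl) t≢a ic′ v∉S
    ... | inj₁ all≡a =
      let t , t∈S , v~t = adjacent-to-selected ic′ v∉S (here refl)
          v~a = subst (Adj v) (All.lookup all≡a t∈S) v~t
          v≢a = λ v≡a → v∉S (subst (_∈ S) (sym v≡a) (here refl))
      in both-hold⇒⇔ (dominatesNew-onlyVertex (twin-free v a v≢a) all≡a) (totDominatesNew-onlyVertex all≡a v~a)

    cgMove⇔tcgMove : ∀ {S v} → IC S → CgMove G S v ⇔ TcgMove G S v
    cgMove⇔tcgMove ic = mk⇔
      (λ (v∉S , new , ic′) → v∉S , Equivalence.to (dominatesNew⇔totDominatesNew ic ic′ v∉S) new , ic′)
      (λ (v∉S , new , ic′) → v∉S , Equivalence.from (dominatesNew⇔totDominatesNew ic ic′ v∉S) new , ic′)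

proposition3p1 : (G : Graph) → 2 ≤ Graph.n G → Connected G
    → (∀ u v → u ≢ v → ¬ ClosedNbhdSubset G u v)
    → ∃ λ k → IsγCg G k × IsγTcg G k
proposition3p1 G n≥2 connected twin-free =
  let k , γcg = GameValue.gameValue G (CgMove G) (InducedConnected G) cgMove-extends (cgMove? G) proj₁
                  (inducedConnected-[] G)
      open GameTransfer G (InducedConnected G) cgMove-extends (cgMove⇔tcgMove G n≥2 connected twin-free)
  in k , γcg , domAtMost-transfer (inducedConnected-[] G) (proj₁ γcg)
             , staAtLeast-transfer (inducedConnected-[] G) (proj₂ γcg)
  where
  cgMove-extends : ∀ {S v} → InducedConnected G S → CgMove G S v → InducedConnected G (v ∷ S)
  cgMove-extends _ (_ , _ , ic′) = ic′
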